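{- Let $\psi_n$ and $\Psi_n$ be defined as in the context. For every $n \geq 1$ and $1 \leq k \leq n$, \[ \|\psi_n\| = n,\qquad \|\Psi_n\| \leq n,\qquad \|B_{n,k}(\psi_1,\ldots,\psi_{n-k+1})\| \leq n . \] Moreover $B_{n,n}(\psi_1) = x_1^n$, so $\|B_{n,n}(\psi_1)\| = n$. Furthermore, for $n \geq 2$, the coefficient of the monomial $x_1$ in $\psi_n$ is $n!$ and the coefficient of the monomial $x_n$ in $\psi_n$ is $(-1)^{n-1}(n-1)!$.
   Context: For a monomial $x_{\gamma_1}x_{\gamma_2}\cdots x_{\gamma_\ell}$ (indices with repetition, i.e. a partition $\gamma$) its partition order is $\gamma_1+\cdots+\gamma_\ell$. For a nonzero polynomial $f \in \mathbb{Z}[x_1,x_2,\ldots]$, $\|f\|$ is the maximum partition order of the monomials occurring in $f$ with nonzero coefficient, and $\|0\| = 0$. Partial Bell polynomials: $B_{N,k}(y_1,\ldots,y_{N-k+1}) = \sum \frac{N!}{j_1!\cdots j_{N-k+1}!}\prod_{i}(y_i/i!)^{j_i}$ over nonnegative integers $j_i$ with $\sum_i i j_i = N$, $\sum_i j_i = k$; $B_N = \sum_{k=1}^N B_{N,k}$. $\sigma^\star_n = (-1)^n B_n(-x_1,-1!\,x_2,\ldots,-(n-1)!\,x_n)$. Stirling numbers of the first kind $S_1(N,k)$ are defined by $x(x-1)\cdots(x-N+1) = \sum_k S_1(N,k)x^k$, and $(n)_k = n!/(n-k)!$. Define $\psi_0 = 0$ and for $n \geq 1$ \[ \psi_n = n\,\psi_{n-1}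 + \sigma^\star_n + \Psi_n,\qquad \Psi_n = \sum_{\nu=2}^{n}\sum_{k=0}^{\min(\nu,n-\nu)} (-1)^{\nu+1} S_1(\nu+1,k+1)\,(n)_k\, B_{n-k,\nu}(\psi_1,\ldots,\psi_{n-k-\nu+1}). \] -}

module Defs where

open import Data.Nat as ℕ using (ℕ; zero; suc; _∸_; _⊔_; _⊓_; _≤ᵇ_; _!)
open import Data.Nat.DivMod using (_/_)
open import Data.Nat.Combinatorics using (_P_)
open import Data.Integer as ℤ using (ℤ; +_; -_)
open import Data.List using (List; []; _∷_; _++_; map; concatMap; foldr; upTo; filter)
open import Data.Nat.ListAction using (sum)
open import Data.List.Properties using (≡-dec)
open import Data.Product using (_×_; _,_; proj₁; proj₂)
open import Data.Bool using (if_then_else_)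
open import Relation.Nullary using (does; ¬_)
open import Relation.Nullary.Decidable using (_×-dec_)
open import Relation.Binary.PropositionalEquality using (_≡_)

-- A monomial x_{γ₁}⋯x_{γℓ} is the list of its indices (with repetition);
-- monomials are compared up to reordering (via sorting).
-- A polynomial is a finite formal sum: a list of (monomial, coefficient)
-- pairs; its meaning is given by `coeff`.

Monomial : Set
Monomial = List ℕ

Poly : Set
Poly = List (Monomial × ℤ)

insert : ℕ → List ℕ → List ℕ
insert x [] = x ∷ []
insert x (y ∷ ys) = if x ≤ᵇ y then x ∷ y ∷ ys else y ∷ insert x ys

sort : List ℕ → List ℕ
sort = foldr insert []

coeff : Poly → Monomial → ℤ
coeff [] m = + 0
coeff ((m′ , c) ∷ f) m =
  if does (≡-dec ℕ._≟_ (sort m′) (sort m)) then c ℤ.+ coeff f m else coeff f m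

order : Monomial → ℕ
order = sum

-- ‖f‖ : maximum partition order of monomials with nonzero coefficient (‖0‖ = 0)
norm : Poly → ℕ
norm f = foldr step 0 f
  where
  step : Monomial × ℤ → ℕ → ℕ
  step (m , _) acc = if does (coeff f m ℤ.≟ + 0) then acc else order m ⊔ acc

0P : Poly
0P = []

1P : Poly
1P = ([] , + 1) ∷ []

x : ℕ → Poly
x i = ((i ∷ []) , + 1) ∷ []

_+P_ : Poly → Poly → Poly
f +P g = f ++ g

scale : ℤ → Poly → Poly
scale a f = map (λ { (m , c) → (m , a ℤ.* c) }) f

_*P_ : Poly → Poly → Poly
f *P g = concatMap (λ { (m , c) → map (λ { (m′ , c′) → (m ++ m′ , c ℤ.* c′) }) g }) f

_^P_ : Poly → ℕ → Poly
f ^P zero = 1P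
f ^P suc j = f *P (f ^P j)

ΣP : List Poly → Poly
ΣP = foldr _+P_ 0P

ΠP : List Poly → Poly
ΠP = foldr _*P_ 1P

-- [a, b] as a list of naturals (empty if b < a)
range : ℕ → ℕ → List ℕ
range a b = map (a ℕ.+_) (upTo (suc b ∸ a))

-- Partial Bell polynomials, literally from the defining sum:
-- B_{N,k}(y₁,…,y_{N-k+1}) = Σ N!/(∏ j_i! (i!)^{j_i}) ∏ y_i^{j_i}
-- over (j₁,…,j_{N-k+1}) with Σ i j_i = N, Σ j_i = k.
-- (The rational coefficient N!/∏ j_i! (i!)^{j_i} is an integer; it is
-- computed by exact natural-number division.)

tuples : ℕ → ℕ → List (List ℕ)
tuples zero N = [] ∷ []
tuples (suc m) N = concatMap (λ j → map (j ∷_) (tuples m N)) (upTo (suc N))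

wsum : ℕ → List ℕ → ℕ
wsum s [] = 0
wsum s (j ∷ js) = s ℕ.* j ℕ.+ wsum (suc s) js

denom : ℕ → List ℕ → ℕ
denom s [] = 1
denom s (j ∷ js) = (j !) ℕ.* ((s !) ℕ.^ j) ℕ.* denom (suc s) js

monoB : (ℕ → Poly) → ℕ → List ℕ → Poly
monoB y s [] = 1P
monoB y s (j ∷ js) = (y s ^P j) *P monoB y (suc s) js

-- exact division (denominator is never 0 in use)
divℕ : ℕ → ℕ → ℕ
divℕ a zero = 0
divℕ a (suc d) = a / suc d

admissible : ℕ → ℕ → List (List ℕ)
admissible N k =
  filter (λ js → (wsum 1 js ℕ.≟ N) ×-dec (sum js ℕ.≟ k)) (tuples (suc N ∸ k) N)

-- B_{N,k}(y₁,…,y_{N-k+1}); only y 1, …, y (N-k+1) are used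
Bell : ℕ → ℕ → (ℕ → Poly) → Poly
Bell N k y = ΣP (map (λ js → scale (+ divℕ (N !) (denom 1 js)) (monoB y 1 js)) (admissible N k))

BellTotal : ℕ → (ℕ → Poly) → Poly
BellTotal N y = ΣP (map (λ k → Bell N k y) (range 1 N))

σ⋆ : ℕ → Poly
σ⋆ n = scale ((- + 1) ℤ.^ n) (BellTotal n (λ i → scale (- (+ ((i ∸ 1) !))) (x i)))

-- Stirling numbers of the first kind, from x(x-1)⋯(x-N+1) = Σ S₁(N,k) x^k.
-- Univariate integer polynomials as coefficient lists (constant term first).

addL : List ℤ → List ℤ → List ℤ
addL [] q = q
addL p [] = p
addL (a ∷ p) (b ∷ q) = (a ℤ.+ b) ∷ addL p q

mulXminus : ℕ → List ℤ → List ℤ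
mulXminus j p = addL (+ 0 ∷ p) (map (λ a → (- (+ j)) ℤ.* a) p)

fallingPoly : ℕ → List ℤ
fallingPoly zero = + 1 ∷ []
fallingPoly (suc N) = mulXminus N (fallingPoly N)

nth : List ℤ → ℕ → ℤ
nth [] _ = + 0
nth (a ∷ _) zero = a
nth (_ ∷ p) (suc k) = nth p k

S₁ : ℕ → ℕ → ℤ
S₁ N k = nth (fallingPoly N) k

-- Ψ_n (parametrised by the sequence ψ it is applied to)

ΨWith : (ℕ → Poly) → ℕ → Poly
ΨWith ψ n =
  ΣP (map (λ ν → ΣP (map (λ k →
        scale ((- + 1) ℤ.^ (ν ℕ.+ 1) ℤ.* S₁ (ν ℕ.+ 1) (k ℕ.+ 1) ℤ.* + (n P k))
              (Bell (n ∸ k) ν ψ))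
      (range 0 (ν ⊓ (n ∸ ν)))))
    (range 2 n))

-- ψtab n i = ψ_i for i ≤ n (ψ₀ = 0; ψ_n = n ψ_{n-1} + σ*_n + Ψ_n)
ψtab : ℕ → ℕ → Poly
ψtab zero i = 0P
ψtab (suc n) i =
  if i ≤ᵇ n then ψtab n i
  else scale (+ suc n) (ψtab n n) +P (σ⋆ (suc n) +P ΨWith (ψtab n) (suc n))

ψ : ℕ → Poly
ψ n = ψtab n n

Ψ : ℕ → Poly
Ψ n = ΨWith ψ n

-- The partition order is additive under products, and a partial Bell polynomial B_{N,k}(y) is a
-- combination of products ∏ y_i^{j_i} with Σ i j_i = N; so B_{N,k}(y) has order at most N as soon as
-- each y_t has order at most t, and induction along the recursion bounds ψ_n, Ψ_n and B_{n,k}(ψ) by n.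
-- For the converse look at linear monomials. Every ψ_t has zero constant term, so B_{N,k}(ψ) has no
-- linear part for k ≥ 2 and Ψ_n contributes nothing linear, whereas B_{N,1}(y) = y_N. Hence the linear
-- part of ψ_n is that of n ψ_{n-1} + σ*_n, where σ*_n contributes (-1)^{n-1} (n-1)! x_n; this yields the
-- coefficients n! of x_1 and (-1)^{n-1} (n-1)! of x_n, and the latter being nonzero forces ‖ψ_n‖ = n.
-- Finally (n) is the only admissible tuple for B_{n,n}, so B_{n,n}(y) = y_1^n.

module Submission where

open import Defs
open import Data.Nat using (ℕ; _≤_; _∸_; _!)
open import Data.Integer using (ℤ; +_; -_; _*_; _^_)
open import Data.List using (_∷_; [])
open import Data.Product using (_×_)
open import Relation.Binary.PropositionalEquality using (_≡_)

open import Data.Bool using (Bool; true; false; T; if_then_else_)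
open import Data.Integer as ℤ using (_+_)
import Data.Integer.Properties as ℤP
open import Data.Integer.Tactic.RingSolver using (solve-∀)
open import Data.List using (List; _++_; map; length; foldr; filter; concatMap; applyUpTo; upTo; replicate)
open import Data.List.Membership.Propositional using (_∈_)
open import Data.List.Properties
  using (≡-dec; ++-identityʳ; length-++; length-map; ∷-injective; concatMap-++; upTo-∷ʳ;
         filter-++; filter-none; filter-≐; filter-accept)
open import Data.List.Relation.Unary.All as All using (All; []; _∷_)
import Data.List.Relation.Unary.All.Properties as AllP
open import Data.List.Relation.Unary.Any using (here; there)
open import Data.Nat as ℕ using (zero; suc; _<_; _⊔_; z≤n; s≤s)
open import Data.Nat.Combinatorics using (_P_)
open import Data.Nat.DivMod using (n/n≡1)
open import Data.Nat.ListAction using (sum)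
open import Data.Nat.ListAction.Properties using (sum-++)
import Data.Nat.Properties as ℕP
open import Algebra.Properties.CommutativeSemigroup ℕP.+-commutativeSemigroup using (x∙yz≈y∙xz)
open import Data.Product using (_,_; proj₁; proj₂; ∃-syntax)
open import Data.Sum using ([_,_]′)
open import Function using (_∘_; id; _⇔_; mk⇔; Equivalence)
open import Relation.Binary.PropositionalEquality using (refl; sym; trans; cong; cong₂; subst; _≢_; module ≡-Reasoning)
open import Relation.Nullary using (does; yes; no; ¬_; contradiction; _×-dec_)
open import Relation.Nullary.Decidable using (dec-false)
open import Relation.Unary using (Decidable; _≐_; ∁)

open ≡-Reasoning

-- Coefficients

constTerm : Poly → ℤ
constTerm f = coeff f []

linCoeff : ℕ → Poly → ℤ
linCoeff i f = coeff f (i ∷ [])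

coeff-∷-≡ : ∀ m′ c f m → sort m′ ≡ sort m → coeff ((m′ , c) ∷ f) m ≡ c + coeff f m
coeff-∷-≡ m′ c f m e with ≡-dec ℕ._≟_ (sort m′) (sort m)
... | yes _ = refl
... | no ne = contradiction e ne

coeff-∷-≢ : ∀ m′ c f m → sort m′ ≢ sort m → coeff ((m′ , c) ∷ f) m ≡ coeff f m
coeff-∷-≢ m′ c f m ne with ≡-dec ℕ._≟_ (sort m′) (sort m)
... | yes e = contradiction e ne
... | no _ = refl

coeff-+P : ∀ f g m → coeff (f +P g) m ≡ coeff f m + coeff g m
coeff-+P [] g m = sym (ℤP.+-identityˡ _)
coeff-+P ((m′ , c) ∷ f) g m with does (≡-dec ℕ._≟_ (sort m′) (sort m))
... | true = trans (cong (λ z → c + z) (coeff-+P f g m)) (sym (ℤP.+-assoc c _ _))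
... | false = coeff-+P f g m

coeff-scale : ∀ a f m → coeff (scale a f) m ≡ a * coeff f m
coeff-scale a [] m = sym (ℤP.*-zeroʳ a)
coeff-scale a ((m′ , c) ∷ f) m with does (≡-dec ℕ._≟_ (sort m′) (sort m))
... | true = trans (cong (λ z → a * c + z) (coeff-scale a f m)) (sym (ℤP.*-distribˡ-+ a c _))
... | false = coeff-scale a f m

coeff-ΣP-zero : ∀ {fs m} → All (λ f → coeff f m ≡ + 0) fs → coeff (ΣP fs) m ≡ + 0
coeff-ΣP-zero [] = refl
coeff-ΣP-zero {f ∷ fs} {m} (p ∷ ps) = trans (coeff-+P f (ΣP fs) m) (cong₂ _+_ p (coeff-ΣP-zero ps))

coeff-ΣP-const : ∀ {fs m v} → All (λ f → coeff f m ≡ v) fs → coeff (ΣP fs) m ≡ + length fs * v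
coeff-ΣP-const {v = v} [] = sym (ℤP.*-zeroˡ v)
coeff-ΣP-const {f ∷ fs} {m} {v} (p ∷ ps) = begin
  coeff (f +P ΣP fs) m              ≡⟨ coeff-+P f (ΣP fs) m ⟩
  coeff f m + coeff (ΣP fs) m       ≡⟨ cong₂ _+_ p (coeff-ΣP-const ps) ⟩
  v + + length fs * v               ≡⟨ cong (λ z → z + + length fs * v) (sym (ℤP.*-identityˡ v)) ⟩
  + 1 * v + + length fs * v         ≡⟨ sym (ℤP.*-distribʳ-+ v (+ 1) (+ length fs)) ⟩
  + length (f ∷ fs) * v             ∎

length-insert : ∀ a l → length (insert a l) ≡ suc (length l)
length-insert a [] = refl
length-insert a (b ∷ l) with a ℕ.≤ᵇ b
... | true = refl
... | false = cong suc (length-insert a l)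

length-sort : ∀ l → length (sort l) ≡ length l
length-sort [] = refl
length-sort (a ∷ l) = trans (length-insert a (sort l)) (cong suc (length-sort l))

order-insert : ∀ a l → order (insert a l) ≡ a ℕ.+ order l
order-insert a [] = refl
order-insert a (b ∷ l) with a ℕ.≤ᵇ b
... | true = refl
... | false = trans (cong (b ℕ.+_) (order-insert a l)) (x∙yz≈y∙xz b a (order l))

order-sort : ∀ l → order (sort l) ≡ order l
order-sort [] = refl
order-sort (a ∷ l) = trans (order-insert a (sort l)) (cong (a ℕ.+_) (order-sort l))

sort-≡⇒length-≡ : ∀ m m′ → sort m ≡ sort m′ → length m ≡ length m′
sort-≡⇒length-≡ m m′ e = trans (sym (length-sort m)) (trans (cong length e) (length-sort m′))

sort-≡⇒order-≡ : ∀ m m′ → sort m ≡ sort m′ → order m ≡ order m′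
sort-≡⇒order-≡ m m′ e = trans (sym (order-sort m)) (trans (cong order e) (order-sort m′))

sort≡[]⇒≡[] : ∀ m → sort m ≡ [] → m ≡ []
sort≡[]⇒≡[] [] e = refl
sort≡[]⇒≡[] (a ∷ m) e with () ← sort-≡⇒length-≡ (a ∷ m) [] e

sort-≢-of-length : ∀ m m′ → length m ≢ length m′ → sort m ≢ sort m′
sort-≢-of-length m m′ ne = ne ∘ sort-≡⇒length-≡ m m′

sort-∷≡singleton : ∀ j m {i} → sort (j ∷ m) ≡ i ∷ [] → j ≡ i × m ≡ []
sort-∷≡singleton j [] e = proj₁ (∷-injective e) , refl
sort-∷≡singleton j (k ∷ m) {i} e with () ← sort-≡⇒length-≡ (j ∷ k ∷ m) (i ∷ []) e

coeff-cong-sort : ∀ f m m′ → sort m ≡ sort m′ → coeff f m ≡ coeff f m′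
coeff-cong-sort [] m m′ e = refl
coeff-cong-sort ((k , c) ∷ f) m m′ e rewrite e =
  cong (λ z → if does (≡-dec ℕ._≟_ (sort k) (sort m′)) then c + z else z) (coeff-cong-sort f m m′ e)

*P-∷ : ∀ t f g → (t ∷ f) *P g ≡ ((t ∷ []) *P g) +P (f *P g)
*P-∷ t f g = cong (_+P (f *P g)) (sym (++-identityʳ _))

coeff-*P-∷ : ∀ t f g m → coeff ((t ∷ f) *P g) m ≡ coeff ((t ∷ []) *P g) m + coeff (f *P g) m
coeff-*P-∷ t f g m = trans (cong (λ h → coeff h m) (*P-∷ t f g)) (coeff-+P ((t ∷ []) *P g) (f *P g) m)

coeff-term*P-matched : ∀ m c g {m₀ r} → (∀ m′ → sort (m ++ m′) ≡ sort m₀ ⇔ sort m′ ≡ sort r) →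
                       coeff (((m , c) ∷ []) *P g) m₀ ≡ c * coeff g r
coeff-term*P-matched m c [] h = sym (ℤP.*-zeroʳ c)
coeff-term*P-matched m c ((m′ , c′) ∷ g) {m₀} {r} h with ≡-dec ℕ._≟_ (sort m′) (sort r)
... | yes e = begin
  coeff ((m ++ m′ , c * c′) ∷ rest) m₀   ≡⟨ coeff-∷-≡ (m ++ m′) (c * c′) rest m₀ (Equivalence.from (h m′) e) ⟩
  c * c′ + coeff rest m₀                 ≡⟨ cong (λ z → c * c′ + z) (coeff-term*P-matched m c g h) ⟩
  c * c′ + c * coeff g r                 ≡⟨ sym (ℤP.*-distribˡ-+ c c′ (coeff g r)) ⟩
  c * (c′ + coeff g r)                   ∎
  where
  rest : Poly
  rest = ((m , c) ∷ []) *P g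
... | no ne = trans (coeff-∷-≢ (m ++ m′) (c * c′) (((m , c) ∷ []) *P g) m₀ (ne ∘ Equivalence.to (h m′)))
                    (coeff-term*P-matched m c g h)

coeff-term*P-unmatched : ∀ m c g {m₀} → (∀ m′ → sort (m ++ m′) ≢ sort m₀) →
                         coeff (((m , c) ∷ []) *P g) m₀ ≡ + 0
coeff-term*P-unmatched m c [] h = refl
coeff-term*P-unmatched m c ((m′ , c′) ∷ g) {m₀} h =
  trans (coeff-∷-≢ (m ++ m′) (c * c′) (((m , c) ∷ []) *P g) m₀ (h m′)) (coeff-term*P-unmatched m c g h)

constTerm-term*P : ∀ t g → constTerm ((t ∷ []) *P g) ≡ constTerm (t ∷ []) * constTerm g
constTerm-term*P ([] , c) g = begin
  constTerm ((([] , c) ∷ []) *P g) ≡⟨ coeff-term*P-matched [] c g (λ _ → mk⇔ id id) ⟩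
  c * constTerm g                  ≡⟨ cong (_* constTerm g) (sym (ℤP.+-identityʳ c)) ⟩
  (c + + 0) * constTerm g          ∎
constTerm-term*P (a ∷ m , c) g = begin
  constTerm (((a ∷ m , c) ∷ []) *P g)         ≡⟨ coeff-term*P-unmatched (a ∷ m) c g
                                                   (λ m′ → sort-≢-of-length (a ∷ m ++ m′) [] (λ ())) ⟩
  + 0                                         ≡⟨ sym (ℤP.*-zeroˡ (constTerm g)) ⟩
  + 0 * constTerm g                           ≡⟨ cong (_* constTerm g)
                                                   (sym (coeff-∷-≢ (a ∷ m) c [] [] (sort-≢-of-length (a ∷ m) [] (λ ())))) ⟩
  constTerm ((a ∷ m , c) ∷ []) * constTerm g ∎

linCoeff-term*P : ∀ i t g →
                  linCoeff i ((t ∷ []) *P g) ≡ constTerm (t ∷ []) * linCoeff i g + linCoeff i (t ∷ []) * constTerm g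
linCoeff-term*P i ([] , c) g = begin
  linCoeff i ((([] , c) ∷ []) *P g)             ≡⟨ coeff-term*P-matched [] c g (λ _ → mk⇔ id id) ⟩
  c * linCoeff i g                              ≡⟨ rearrange c (linCoeff i g) (constTerm g) ⟩
  (c + + 0) * linCoeff i g + + 0 * constTerm g ∎
  where
  rearrange : ∀ c l k → c * l ≡ (c + + 0) * l + + 0 * k
  rearrange = solve-∀
linCoeff-term*P i (j ∷ [] , c) g with j ℕ.≟ i
... | yes refl = begin
  linCoeff i (((i ∷ [] , c) ∷ []) *P g)         ≡⟨ coeff-term*P-matched (i ∷ []) c g leading-i ⟩
  c * constTerm g                               ≡⟨ rearrange c (linCoeff i g) (constTerm g) ⟩
  + 0 * linCoeff i g + (c + + 0) * constTerm g  ≡⟨ cong (λ z → + 0 * linCoeff i g + z * constTerm g)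
                                                      (sym (coeff-∷-≡ (i ∷ []) c [] (i ∷ []) refl)) ⟩
  + 0 * linCoeff i g + linCoeff i ((i ∷ [] , c) ∷ []) * constTerm g ∎
  where
  leading-i : ∀ m′ → sort (i ∷ m′) ≡ sort (i ∷ []) ⇔ sort m′ ≡ sort []
  leading-i m′ = mk⇔ (λ e → cong sort (proj₂ (sort-∷≡singleton i m′ e)))
                     (λ e → cong (λ z → sort (i ∷ z)) (sort≡[]⇒≡[] m′ e))
  rearrange : ∀ c l k → c * k ≡ + 0 * l + (c + + 0) * k
  rearrange = solve-∀
... | no j≢i = begin
  linCoeff i (((j ∷ [] , c) ∷ []) *P g)         ≡⟨ coeff-term*P-unmatched (j ∷ []) c g
                                                      (λ m′ e → j≢i (proj₁ (sort-∷≡singleton j m′ e))) ⟩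
  + 0                                           ≡⟨ zero-sum (linCoeff i g) (constTerm g) ⟩
  + 0 * linCoeff i g + + 0 * constTerm g       ≡⟨ cong (λ z → + 0 * linCoeff i g + z * constTerm g)
                                                      (sym (coeff-∷-≢ (j ∷ []) c [] (i ∷ [])
                                                             (j≢i ∘ proj₁ ∘ ∷-injective))) ⟩
  + 0 * linCoeff i g + linCoeff i ((j ∷ [] , c) ∷ []) * constTerm g ∎
  where
  zero-sum : ∀ l k → + 0 ≡ + 0 * l + + 0 * k
  zero-sum = solve-∀
linCoeff-term*P i (a ∷ b ∷ m , c) g = begin
  linCoeff i (((a ∷ b ∷ m , c) ∷ []) *P g)     ≡⟨ coeff-term*P-unmatched (a ∷ b ∷ m) c g
                                                     (λ m′ → sort-≢-of-length (a ∷ b ∷ m ++ m′) (i ∷ []) (λ ())) ⟩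
  + 0                                          ≡⟨ zero-sum (linCoeff i g) (constTerm g) ⟩
  + 0 * linCoeff i g + + 0 * constTerm g      ≡⟨ sym (cong₂ (λ u v → u * linCoeff i g + v * constTerm g)
                                                     (coeff-∷-≢ (a ∷ b ∷ m) c [] [] (sort-≢-of-length (a ∷ b ∷ m) [] (λ ())))
                                                     (coeff-∷-≢ (a ∷ b ∷ m) c [] (i ∷ [])
                                                                (sort-≢-of-length (a ∷ b ∷ m) (i ∷ []) (λ ())))) ⟩
  constTerm ((a ∷ b ∷ m , c) ∷ []) * linCoeff i g + linCoeff i ((a ∷ b ∷ m , c) ∷ []) * constTerm g ∎
  where
  zero-sum : ∀ l k → + 0 ≡ + 0 * l + + 0 * k
  zero-sum = solve-∀

constTerm-*P : ∀ f g → constTerm (f *P g) ≡ constTerm f * constTerm g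
constTerm-*P [] g = sym (ℤP.*-zeroˡ (constTerm g))
constTerm-*P (t ∷ f) g = begin
  constTerm ((t ∷ f) *P g)                                      ≡⟨ coeff-*P-∷ t f g [] ⟩
  constTerm ((t ∷ []) *P g) + constTerm (f *P g)                ≡⟨ cong₂ _+_ (constTerm-term*P t g) (constTerm-*P f g) ⟩
  constTerm (t ∷ []) * constTerm g + constTerm f * constTerm g  ≡⟨ sym (ℤP.*-distribʳ-+ (constTerm g) (constTerm (t ∷ [])) _) ⟩
  (constTerm (t ∷ []) + constTerm f) * constTerm g              ≡⟨ cong (_* constTerm g) (sym (coeff-+P (t ∷ []) f [])) ⟩
  constTerm (t ∷ f) * constTerm g                               ∎

linCoeff-*P : ∀ i f g → linCoeff i (f *P g) ≡ constTerm f * linCoeff i g + linCoeff i f * constTerm g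
linCoeff-*P i [] g = sym (cong₂ _+_ (ℤP.*-zeroˡ (linCoeff i g)) (ℤP.*-zeroˡ (constTerm g)))
linCoeff-*P i (t ∷ f) g = begin
  linCoeff i ((t ∷ f) *P g)                                 ≡⟨ coeff-*P-∷ t f g (i ∷ []) ⟩
  linCoeff i ((t ∷ []) *P g) + linCoeff i (f *P g)          ≡⟨ cong₂ _+_ (linCoeff-term*P i t g) (linCoeff-*P i f g) ⟩
  (c₀ * l + l₀ * k) + (c₁ * l + l₁ * k)                     ≡⟨ rearrange c₀ c₁ l₀ l₁ l k ⟩
  (c₀ + c₁) * l + (l₀ + l₁) * k                             ≡⟨ sym (cong₂ (λ u v → u * l + v * k)
                                                                 (coeff-+P (t ∷ []) f []) (coeff-+P (t ∷ []) f (i ∷ []))) ⟩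
  constTerm (t ∷ f) * l + linCoeff i (t ∷ f) * k            ∎
  where
  c₀ c₁ l₀ l₁ l k : ℤ
  c₀ = constTerm (t ∷ [])
  c₁ = constTerm f
  l₀ = linCoeff i (t ∷ [])
  l₁ = linCoeff i f
  l = linCoeff i g
  k = constTerm g
  rearrange : ∀ c₀ c₁ l₀ l₁ l k → (c₀ * l + l₀ * k) + (c₁ * l + l₁ * k) ≡ (c₀ + c₁) * l + (l₀ + l₁) * k
  rearrange = solve-∀

*P-identityˡ : ∀ g → 1P *P g ≡ g
*P-identityˡ [] = refl
*P-identityˡ ((m , c) ∷ g) = cong₂ _∷_ (cong (m ,_) (ℤP.*-identityˡ c)) (*P-identityˡ g)

*P-identityʳ : ∀ f → f *P 1P ≡ f
*P-identityʳ [] = refl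
*P-identityʳ ((m , c) ∷ f) = cong₂ _∷_ (cong₂ _,_ (++-identityʳ m) (ℤP.*-identityʳ c)) (*P-identityʳ f)

constTerm-*P-zeroˡ : ∀ f g → constTerm f ≡ + 0 → constTerm (f *P g) ≡ + 0
constTerm-*P-zeroˡ f g f₀ =
  trans (constTerm-*P f g) (trans (cong (_* constTerm g) f₀) (ℤP.*-zeroˡ (constTerm g)))

constTerm-^P-suc : ∀ f j → constTerm f ≡ + 0 → constTerm (f ^P suc j) ≡ + 0
constTerm-^P-suc f j f₀ = constTerm-*P-zeroˡ f (f ^P j) f₀

linCoeff-*P-of-constTerms : ∀ i f g → constTerm f ≡ + 0 → constTerm g ≡ + 0 → linCoeff i (f *P g) ≡ + 0
linCoeff-*P-of-constTerms i f g f₀ g₀ = begin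
  linCoeff i (f *P g)                                      ≡⟨ linCoeff-*P i f g ⟩
  constTerm f * linCoeff i g + linCoeff i f * constTerm g  ≡⟨ cong₂ (λ u v → u * linCoeff i g + linCoeff i f * v) f₀ g₀ ⟩
  + 0 * linCoeff i g + linCoeff i f * + 0                  ≡⟨ cong₂ _+_ (ℤP.*-zeroˡ (linCoeff i g)) (ℤP.*-zeroʳ (linCoeff i f)) ⟩
  + 0                                                      ∎

linCoeff-*P-of-flatˡ : ∀ i f g → constTerm f ≡ + 0 → linCoeff i f ≡ + 0 → linCoeff i (f *P g) ≡ + 0
linCoeff-*P-of-flatˡ i f g f₀ f₁ = begin
  linCoeff i (f *P g)                                      ≡⟨ linCoeff-*P i f g ⟩
  constTerm f * linCoeff i g + linCoeff i f * constTerm g  ≡⟨ cong₂ (λ u v → u * linCoeff i g + v * constTerm g) f₀ f₁ ⟩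
  + 0 * linCoeff i g + + 0 * constTerm g                   ≡⟨ cong₂ _+_ (ℤP.*-zeroˡ (linCoeff i g)) (ℤP.*-zeroˡ (constTerm g)) ⟩
  + 0                                                      ∎

-- Partition order and the norm

OrderAtMost : ℕ → Poly → Set
OrderAtMost b = All (λ t → order (proj₁ t) ≤ b)

orderAtMost-mono : ∀ {a b f} → a ≤ b → OrderAtMost a f → OrderAtMost b f
orderAtMost-mono a≤b = All.map (λ p → ℕP.≤-trans p a≤b)

orderAtMost-scale : ∀ {b f} a → OrderAtMost b f → OrderAtMost b (scale a f)
orderAtMost-scale a = AllP.map⁺

orderAtMost-*P : ∀ {a b f g} → OrderAtMost a f → OrderAtMost b g → OrderAtMost (a ℕ.+ b) (f *P g)
orderAtMost-*P bf bg = AllP.concat⁺ (AllP.map⁺ (All.map (λ {t} p → AllP.map⁺ (All.map (λ {t′} q →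
  subst (ℕ._≤ _) (sym (sum-++ (proj₁ t) (proj₁ t′))) (ℕP.+-mono-≤ p q)) bg)) bf))

orderAtMost-1P : ∀ b → OrderAtMost b 1P
orderAtMost-1P b = z≤n ∷ []

orderAtMost-^P : ∀ {a f} j → OrderAtMost a f → OrderAtMost (j ℕ.* a) (f ^P j)
orderAtMost-^P zero bf = orderAtMost-1P 0
orderAtMost-^P (suc j) bf = orderAtMost-*P bf (orderAtMost-^P j bf)

orderAtMost-ΣP : ∀ {b fs} → All (OrderAtMost b) fs → OrderAtMost b (ΣP fs)
orderAtMost-ΣP [] = []
orderAtMost-ΣP (bf ∷ bfs) = AllP.++⁺ bf (orderAtMost-ΣP bfs)

-- norm folds a step function local to its definition, so that function is described here only by its
-- defining equation.
module NormFold (step : Monomial × ℤ → ℕ → ℕ) (dropped : Monomial → Bool)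
                (step-def : ∀ m c a → step (m , c) a ≡ (if dropped m then a else order m ⊔ a)) where

  foldr-≤ : ∀ {b} l → OrderAtMost b l → foldr step 0 l ≤ b
  foldr-≤ [] [] = z≤n
  foldr-≤ ((m , c) ∷ l) (p ∷ bl) rewrite step-def m c (foldr step 0 l) with dropped m
  ... | true = foldr-≤ l bl
  ... | false = ℕP.⊔-lub p (foldr-≤ l bl)

  ≤-foldr : ∀ {m c} l → (m , c) ∈ l → dropped m ≡ false → order m ≤ foldr step 0 l
  ≤-foldr {m} {c} ((m , c) ∷ l) (here refl) kept rewrite step-def m c (foldr step 0 l) | kept =
    ℕP.m≤m⊔n (order m) _
  ≤-foldr ((m′ , c′) ∷ l) (there m∈l) kept rewrite step-def m′ c′ (foldr step 0 l) with dropped m′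
  ... | true = ≤-foldr l m∈l kept
  ... | false = ℕP.≤-trans (≤-foldr l m∈l kept) (ℕP.m≤n⊔m (order m′) _)

norm-≤ : ∀ {b} f → OrderAtMost b f → norm f ≤ b
norm-≤ f = NormFold.foldr-≤ _ (λ m → does (coeff f m ℤ.≟ + 0)) (λ _ _ _ → refl) f

∈-of-coeff≢0 : ∀ f m → coeff f m ≢ + 0 → ∃[ m′ ] ∃[ c ] (m′ , c) ∈ f × sort m′ ≡ sort m
∈-of-coeff≢0 [] m ne = contradiction refl ne
∈-of-coeff≢0 ((m′ , c) ∷ f) m ne with ≡-dec ℕ._≟_ (sort m′) (sort m)
... | yes e = m′ , c , here refl , e
... | no _ with ∈-of-coeff≢0 f m ne
... | m″ , c″ , m″∈f , e = m″ , c″ , there m″∈f , e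

order≤norm : ∀ f m → coeff f m ≢ + 0 → order m ≤ norm f
order≤norm f m ne with ∈-of-coeff≢0 f m ne
... | m′ , c , m′∈f , e = subst (_≤ norm f) (sort-≡⇒order-≡ m′ m e)
  (NormFold.≤-foldr _ (λ m → does (coeff f m ℤ.≟ + 0)) (λ _ _ _ → refl) f m′∈f
    (dec-false (coeff f m′ ℤ.≟ + 0) (ne ∘ trans (sym (coeff-cong-sort f m′ m e)))))

coeff-beyond-order : ∀ {b} f m → OrderAtMost b f → b < order m → coeff f m ≡ + 0
coeff-beyond-order [] m [] _ = refl
coeff-beyond-order ((m′ , c) ∷ f) m (p ∷ bf) b<m with ≡-dec ℕ._≟_ (sort m′) (sort m)
... | yes e = contradiction (subst (_≤ _) (sort-≡⇒order-≡ m′ m e) p) (ℕP.<⇒≱ b<m)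
... | no _ = coeff-beyond-order f m bf b<m

-- Partial Bell polynomials

wsum-0∷ : ∀ s js → wsum s (0 ∷ js) ≡ wsum (suc s) js
wsum-0∷ s js = cong (ℕ._+ wsum (suc s) js) (ℕP.*-zeroʳ s)

wsum-sum≡0 : ∀ s js → sum js ≡ 0 → wsum s js ≡ 0
wsum-sum≡0 s [] _ = refl
wsum-sum≡0 s (zero ∷ js) p = trans (wsum-0∷ s js) (wsum-sum≡0 (suc s) js p)

wsum-unit : ∀ s js → sum js ≡ 0 → wsum s (1 ∷ js) ≡ s
wsum-unit s js p = trans (cong₂ ℕ._+_ (ℕP.*-identityʳ s) (wsum-sum≡0 (suc s) js p)) (ℕP.+-identityʳ s)

monoB-sum≡0 : ∀ y s js → sum js ≡ 0 → monoB y s js ≡ 1P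
monoB-sum≡0 y s [] _ = refl
monoB-sum≡0 y s (zero ∷ js) p = trans (*P-identityˡ (monoB y (suc s) js)) (monoB-sum≡0 y (suc s) js p)

monoB-sum≡1 : ∀ y s js → sum js ≡ 1 → monoB y s js ≡ y (wsum s js)
monoB-sum≡1 y s (zero ∷ js) p = begin
  1P *P monoB y (suc s) js   ≡⟨ *P-identityˡ (monoB y (suc s) js) ⟩
  monoB y (suc s) js         ≡⟨ monoB-sum≡1 y (suc s) js p ⟩
  y (wsum (suc s) js)        ≡⟨ cong y (sym (wsum-0∷ s js)) ⟩
  y (wsum s (0 ∷ js))        ∎
monoB-sum≡1 y s (suc zero ∷ js) p = begin
  (y s *P 1P) *P monoB y (suc s) js  ≡⟨ cong₂ _*P_ (*P-identityʳ (y s)) (monoB-sum≡0 y (suc s) js (ℕP.suc-injective p)) ⟩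
  y s *P 1P                          ≡⟨ *P-identityʳ (y s) ⟩
  y s                                ≡⟨ cong y (sym (wsum-unit s js (ℕP.suc-injective p))) ⟩
  y (wsum s (1 ∷ js))                ∎

denom-sum≡0 : ∀ s js → sum js ≡ 0 → denom s js ≡ 1
denom-sum≡0 s [] _ = refl
denom-sum≡0 s (zero ∷ js) p = trans (ℕP.*-identityˡ (denom (suc s) js)) (denom-sum≡0 (suc s) js p)

denom-sum≡1 : ∀ s js → sum js ≡ 1 → denom s js ≡ wsum s js !
denom-sum≡1 s (zero ∷ js) p = begin
  1 ℕ.* denom (suc s) js   ≡⟨ ℕP.*-identityˡ (denom (suc s) js) ⟩
  denom (suc s) js         ≡⟨ denom-sum≡1 (suc s) js p ⟩
  wsum (suc s) js !        ≡⟨ cong _! (sym (wsum-0∷ s js)) ⟩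
  wsum s (0 ∷ js) !        ∎
denom-sum≡1 s (suc zero ∷ js) p = begin
  1 ℕ.* (s ! ℕ.* 1) ℕ.* denom (suc s) js  ≡⟨ cong₂ ℕ._*_ (ℕP.*-identityˡ (s ! ℕ.* 1))
                                                         (denom-sum≡0 (suc s) js (ℕP.suc-injective p)) ⟩
  s ! ℕ.* 1 ℕ.* 1                         ≡⟨ trans (ℕP.*-identityʳ (s ! ℕ.* 1)) (ℕP.*-identityʳ (s !)) ⟩
  s !                                     ≡⟨ cong _! (sym (wsum-unit s js (ℕP.suc-injective p))) ⟩
  wsum s (1 ∷ js) !                       ∎

module _ {y : ℕ → Poly} (no-const : ∀ t → constTerm (y t) ≡ + 0) where

  constTerm-monoB : ∀ s js → 1 ≤ sum js → constTerm (monoB y s js) ≡ + 0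
  constTerm-monoB s (zero ∷ js) p =
    trans (cong constTerm (*P-identityˡ (monoB y (suc s) js))) (constTerm-monoB (suc s) js p)
  constTerm-monoB s (suc j ∷ js) _ =
    constTerm-*P-zeroˡ (y s ^P suc j) (monoB y (suc s) js) (constTerm-^P-suc (y s) j (no-const s))

  linCoeff-monoB : ∀ i s js → 2 ≤ sum js → linCoeff i (monoB y s js) ≡ + 0
  linCoeff-monoB i s (zero ∷ js) p =
    trans (cong (linCoeff i) (*P-identityˡ (monoB y (suc s) js))) (linCoeff-monoB i (suc s) js p)
  linCoeff-monoB i s (suc zero ∷ js) (s≤s p) =
    linCoeff-*P-of-constTerms i (y s ^P 1) (monoB y (suc s) js)
      (constTerm-^P-suc (y s) 0 (no-const s)) (constTerm-monoB (suc s) js p)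
  linCoeff-monoB i s (suc (suc j) ∷ js) _ =
    linCoeff-*P-of-flatˡ i (y s ^P suc (suc j)) (monoB y (suc s) js)
      (constTerm-^P-suc (y s) (suc j) (no-const s))
      (linCoeff-*P-of-constTerms i (y s) (y s ^P suc j) (no-const s) (constTerm-^P-suc (y s) j (no-const s)))

orderAtMost-monoB : ∀ {y} → (∀ t → OrderAtMost t (y t)) → ∀ s js → OrderAtMost (wsum s js) (monoB y s js)
orderAtMost-monoB hy s [] = orderAtMost-1P 0
orderAtMost-monoB {y} hy s (j ∷ js) =
  subst (λ z → OrderAtMost (z ℕ.+ wsum (suc s) js) (monoB y s (j ∷ js))) (ℕP.*-comm j s)
    (orderAtMost-*P (orderAtMost-^P j (hy s)) (orderAtMost-monoB hy (suc s) js))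

Admissible : ℕ → ℕ → ℕ → List ℕ → Set
Admissible s N k js = wsum s js ≡ N × sum js ≡ k

admissible? : ∀ s N k → Decidable (Admissible s N k)
admissible? s N k js = (wsum s js ℕ.≟ N) ×-dec (sum js ℕ.≟ k)

admissible-sound : ∀ N k → All (Admissible 1 N k) (admissible N k)
admissible-sound N k = AllP.all-filter (admissible? 1 N k) (tuples (suc N ∸ k) N)

count : ∀ {A : Set} {P : A → Set} → Decidable P → List A → ℕ
count P? xs = length (filter P? xs)

count-++ : ∀ {A : Set} {P : A → Set} (P? : Decidable P) xs ys → count P? (xs ++ ys) ≡ count P? xs ℕ.+ count P? ys
count-++ P? xs ys = trans (cong length (filter-++ P? xs ys)) (length-++ (filter P? xs))

count-map : ∀ {A B : Set} {P : B → Set} (P? : Decidable P) (f : A → B) xs → count P? (map f xs) ≡ count (P? ∘ f) xs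
count-map P? f [] = refl
count-map P? f (x ∷ xs) with does (P? (f x))
... | true = cong suc (count-map P? f xs)
... | false = count-map P? f xs

count-≐ : ∀ {A : Set} {P Q : A → Set} (P? : Decidable P) (Q? : Decidable Q) → P ≐ Q → ∀ xs → count P? xs ≡ count Q? xs
count-≐ P? Q? P≐Q xs = cong length (filter-≐ P? Q? P≐Q xs)

count-none : ∀ {A : Set} {P : A → Set} (P? : Decidable P) {xs} → All (∁ P) xs → count P? xs ≡ 0
count-none P? none = cong length (filter-none P? none)

count-none-prefixed : ∀ {P : List ℕ → Set} (P? : Decidable P) Ts {l} → All (λ j → ∀ js → ¬ P (j ∷ js)) l →
                      count P? (concatMap (λ j → map (j ∷_) Ts) l) ≡ 0
count-none-prefixed P? Ts H =
  count-none P? (AllP.concat⁺ (AllP.map⁺ (All.map (λ h → AllP.map⁺ (All.universal h Ts)) H)))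

sum≡0? : Decidable (λ js → sum js ≡ 0)
sum≡0? js = sum js ℕ.≟ 0

count-sum≡0 : ∀ m B → count sum≡0? (tuples m B) ≡ 1
count-sum≡0 zero B = refl
count-sum≡0 (suc m) B = begin
  count sum≡0? (map (0 ∷_) (tuples m B) ++ rest)               ≡⟨ count-++ sum≡0? (map (0 ∷_) (tuples m B)) rest ⟩
  count sum≡0? (map (0 ∷_) (tuples m B)) ℕ.+ count sum≡0? rest  ≡⟨ cong₂ ℕ._+_ (count-map sum≡0? (0 ∷_) (tuples m B))
                                                                     (count-none-prefixed sum≡0? (tuples m B)
                                                                        (AllP.applyUpTo⁺₂ suc B (λ _ _ ()))) ⟩
  count sum≡0? (tuples m B) ℕ.+ 0                               ≡⟨ ℕP.+-identityʳ _ ⟩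
  count sum≡0? (tuples m B)                                     ≡⟨ count-sum≡0 m B ⟩
  1                                                             ∎
  where
  rest : List (List ℕ)
  rest = concatMap (λ j → map (j ∷_) (tuples m B)) (applyUpTo suc B)

-- Among tuples of length m, the only one with entry sum 1 and weighted sum W (weights s, s + 1, …) is
-- the unit vector at position W ∸ s, present exactly when s ≤ W < s + m.
count-unit-suc : ∀ m B s W → count (admissible? s W 1) (tuples (suc m) (suc B))
  ≡ count (admissible? (suc s) W 1) (tuples m (suc B)) ℕ.+ count (admissible? s W 1) (map (1 ∷_) (tuples m (suc B)))
count-unit-suc m B s W = begin
  count P? (map (0 ∷_) Ts ++ (ones ++ rest))               ≡⟨ count-++ P? (map (0 ∷_) Ts) (ones ++ rest) ⟩
  count P? (map (0 ∷_) Ts) ℕ.+ count P? (ones ++ rest)     ≡⟨ cong₂ ℕ._+_ shift (count-++ P? ones rest) ⟩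
  count Q? Ts ℕ.+ (count P? ones ℕ.+ count P? rest)        ≡⟨ cong (λ z → count Q? Ts ℕ.+ (count P? ones ℕ.+ z))
                                                                (count-none-prefixed P? Ts
                                                                   (AllP.applyUpTo⁺₂ (suc ∘ suc) B (λ _ _ ()))) ⟩
  count Q? Ts ℕ.+ (count P? ones ℕ.+ 0)                    ≡⟨ cong (count Q? Ts ℕ.+_) (ℕP.+-identityʳ (count P? ones)) ⟩
  count Q? Ts ℕ.+ count P? ones                            ∎
  where
  P? : Decidable (Admissible s W 1)
  P? = admissible? s W 1
  Q? : Decidable (Admissible (suc s) W 1)
  Q? = admissible? (suc s) W 1
  Ts ones rest : List (List ℕ)
  Ts = tuples m (suc B)
  ones = map (1 ∷_) Ts
  rest = concatMap (λ j → map (j ∷_) Ts) (applyUpTo (suc ∘ suc) B)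
  shifted : Admissible s W 1 ∘ (0 ∷_) ≐ Admissible (suc s) W 1
  shifted = (λ {js} (w , k) → trans (sym (wsum-0∷ s js)) w , k) , (λ {js} (w , k) → trans (wsum-0∷ s js) w , k)
  shift : count P? (map (0 ∷_) Ts) ≡ count Q? Ts
  shift = trans (count-map P? (0 ∷_) Ts) (count-≐ (P? ∘ (0 ∷_)) Q? shifted Ts)

count-unit-head-≡ : ∀ m B s → count (admissible? s s 1) (map (1 ∷_) (tuples m B)) ≡ 1
count-unit-head-≡ m B s = begin
  count (admissible? s s 1) (map (1 ∷_) (tuples m B))  ≡⟨ count-map (admissible? s s 1) (1 ∷_) (tuples m B) ⟩
  count (admissible? s s 1 ∘ (1 ∷_)) (tuples m B)      ≡⟨ count-≐ (admissible? s s 1 ∘ (1 ∷_)) sum≡0? rest-zero (tuples m B) ⟩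
  count sum≡0? (tuples m B)                            ≡⟨ count-sum≡0 m B ⟩
  1                                                    ∎
  where
  rest-zero : Admissible s s 1 ∘ (1 ∷_) ≐ (λ js → sum js ≡ 0)
  rest-zero = (λ (_ , k) → ℕP.suc-injective k) , (λ {js} z → wsum-unit s js z , cong suc z)

count-unit-head-≢ : ∀ m B s W → s ≢ W → count (admissible? s W 1) (map (1 ∷_) (tuples m B)) ≡ 0
count-unit-head-≢ m B s W s≢W = count-none (admissible? s W 1)
  (AllP.map⁺ (All.universal (λ js (w , k) → s≢W (trans (sym (wsum-unit s js (ℕP.suc-injective k))) w)) (tuples m B)))

count-unit-below : ∀ m B s W → W < s → count (admissible? s W 1) (tuples m (suc B)) ≡ 0
count-unit-below zero B s W W<s = count-none (admissible? s W 1) {[] ∷ []} ((λ ()) ∘ proj₂ ∷ [])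
count-unit-below (suc m) B s W W<s = trans (count-unit-suc m B s W)
  (cong₂ ℕ._+_ (count-unit-below m B (suc s) W (ℕP.m<n⇒m<1+n W<s))
               (count-unit-head-≢ m (suc B) s W (λ s≡W → ℕP.<-irrefl (sym s≡W) W<s)))

count-unit-hit : ∀ m B s k → k < m → count (admissible? s (s ℕ.+ k) 1) (tuples m (suc B)) ≡ 1
count-unit-hit (suc m) B s zero _ = trans (count-unit-suc m B s (s ℕ.+ 0))
  (cong₂ ℕ._+_ (count-unit-below m B (suc s) (s ℕ.+ 0) (s≤s (ℕP.≤-reflexive (ℕP.+-identityʳ s))))
               (subst (λ W → count (admissible? s W 1) (map (1 ∷_) (tuples m (suc B))) ≡ 1)
                      (sym (ℕP.+-identityʳ s)) (count-unit-head-≡ m (suc B) s)))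
count-unit-hit (suc m) B s (suc k) (s≤s k<m) = trans (count-unit-suc m B s (s ℕ.+ suc k))
  (cong₂ ℕ._+_ (subst (λ W → count (admissible? (suc s) W 1) (tuples m (suc B)) ≡ 1)
                      (sym (ℕP.+-suc s k)) (count-unit-hit m B (suc s) k k<m))
               (count-unit-head-≢ m (suc B) s (s ℕ.+ suc k) (λ e → ℕP.m≢1+m+n s (trans e (ℕP.+-suc s k)))))

length-admissible-unit : ∀ N → 1 ≤ N → length (admissible N 1) ≡ 1
length-admissible-unit (suc N) _ = count-unit-hit (suc N) N 1 N (ℕP.n<1+n N)

admissible-diagonal : ∀ n → admissible n n ≡ (n ∷ []) ∷ []
admissible-diagonal n = begin
  filter P? (tuples (suc n ∸ n) n)                           ≡⟨ cong (λ m → filter P? (tuples m n)) (ℕP.m+n∸n≡m 1 n) ⟩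
  filter P? (concatMap singleton (upTo (suc n)))             ≡⟨ cong (filter P? ∘ concatMap singleton) (sym (upTo-∷ʳ n)) ⟩
  filter P? (concatMap singleton (upTo n ++ n ∷ []))         ≡⟨ cong (filter P?) (concatMap-++ singleton (upTo n) (n ∷ [])) ⟩
  filter P? (concatMap singleton (upTo n) ++ (n ∷ []) ∷ [])  ≡⟨ filter-++ P? (concatMap singleton (upTo n)) ((n ∷ []) ∷ []) ⟩
  filter P? (concatMap singleton (upTo n))
    ++ filter P? ((n ∷ []) ∷ [])                             ≡⟨ cong₂ _++_ (filter-none P? below) (filter-accept P? diagonal) ⟩
  (n ∷ []) ∷ []                                              ∎
  where
  P? : Decidable (Admissible 1 n n)
  P? = admissible? 1 n n
  singleton : ℕ → List (List ℕ)
  singleton j = map (j ∷_) ([] ∷ [])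
  below : All (∁ (Admissible 1 n n)) (concatMap singleton (upTo n))
  below = AllP.concat⁺ (AllP.map⁺ (AllP.applyUpTo⁺₁ id n
    (λ j<n → (λ (_ , k) → ℕP.<-irrefl (trans (sym (ℕP.+-identityʳ _)) k) j<n) ∷ [])))
  diagonal : Admissible 1 n n (n ∷ [])
  diagonal = trans (ℕP.+-identityʳ (1 ℕ.* n)) (ℕP.*-identityˡ n) , ℕP.+-identityʳ n

BellTerm : ℕ → (ℕ → Poly) → List ℕ → Poly
BellTerm N y js = scale (+ divℕ (N !) (denom 1 js)) (monoB y 1 js)

coeff-BellTerm : ∀ N y js m → denom 1 js ≡ N ! → coeff (BellTerm N y js) m ≡ coeff (monoB y 1 js) m
coeff-BellTerm N y js m d = begin
  coeff (BellTerm N y js) m                          ≡⟨ coeff-scale (+ divℕ (N !) (denom 1 js)) (monoB y 1 js) m ⟩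
  + divℕ (N !) (denom 1 js) * coeff (monoB y 1 js) m ≡⟨ cong (λ q → + divℕ (N !) q * coeff (monoB y 1 js) m) d ⟩
  + divℕ (N !) (N !) * coeff (monoB y 1 js) m        ≡⟨ cong (λ q → + q * coeff (monoB y 1 js) m) divℕ-! ⟩
  + 1 * coeff (monoB y 1 js) m                       ≡⟨ ℤP.*-identityˡ (coeff (monoB y 1 js) m) ⟩
  coeff (monoB y 1 js) m                             ∎
  where
  divℕ-! : divℕ (N !) (N !) ≡ 1
  divℕ-! with N ! | ℕP.1≤n! N
  ... | suc a | _ = n/n≡1 (suc a)

coeff-Bell-const : ∀ N k y m {v} → (∀ {js} → Admissible 1 N k js → coeff (BellTerm N y js) m ≡ v) →
                   coeff (Bell N k y) m ≡ + length (admissible N k) * v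
coeff-Bell-const N k y m {v} h =
  trans (coeff-ΣP-const (AllP.map⁺ (All.map (λ {js} → h {js}) (admissible-sound N k))))
        (cong (λ ℓ → + ℓ * v) (length-map (BellTerm N y) (admissible N k)))

coeff-Bell-zero : ∀ N k y m → (∀ {js} → Admissible 1 N k js → coeff (monoB y 1 js) m ≡ + 0) → coeff (Bell N k y) m ≡ + 0
coeff-Bell-zero N k y m h = coeff-ΣP-zero (AllP.map⁺ (All.map (λ {js} → term {js}) (admissible-sound N k)))
  where
  term : ∀ {js} → Admissible 1 N k js → coeff (BellTerm N y js) m ≡ + 0
  term {js} a = trans (coeff-scale c (monoB y 1 js) m) (trans (cong (c *_) (h {js} a)) (ℤP.*-zeroʳ c))
    where
    c : ℤ
    c = + divℕ (N !) (denom 1 js)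

orderAtMost-Bell : ∀ {y} → (∀ t → OrderAtMost t (y t)) → ∀ N k → OrderAtMost N (Bell N k y)
orderAtMost-Bell {y} hy N k = orderAtMost-ΣP (AllP.map⁺ (All.map (λ {js} (w , _) →
    orderAtMost-scale (+ divℕ (N !) (denom 1 js))
      (subst (λ b → OrderAtMost b (monoB y 1 js)) w (orderAtMost-monoB hy 1 js)))
  (admissible-sound N k)))

coeff-Bell-unit : ∀ N y m → 1 ≤ N → coeff (Bell N 1 y) m ≡ coeff (y N) m
coeff-Bell-unit N y m N≥1 = begin
  coeff (Bell N 1 y) m                       ≡⟨ coeff-Bell-const N 1 y m (λ {js} → term {js}) ⟩
  + length (admissible N 1) * coeff (y N) m  ≡⟨ cong (λ ℓ → + ℓ * coeff (y N) m) (length-admissible-unit N N≥1) ⟩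
  + 1 * coeff (y N) m                        ≡⟨ ℤP.*-identityˡ (coeff (y N) m) ⟩
  coeff (y N) m                              ∎
  where
  term : ∀ {js} → Admissible 1 N 1 js → coeff (BellTerm N y js) m ≡ coeff (y N) m
  term {js} (w , k) = trans (coeff-BellTerm N y js m (trans (denom-sum≡1 1 js k) (cong _! w)))
                            (cong (λ f → coeff f m) (trans (monoB-sum≡1 y 1 js k) (cong y w)))

coeff-Bell-diagonal : ∀ n y m → coeff (Bell n n y) m ≡ coeff (y 1 ^P n) m
coeff-Bell-diagonal n y m = begin
  coeff (ΣP (map (BellTerm n y) (admissible n n))) m  ≡⟨ cong (λ js → coeff (ΣP (map (BellTerm n y) js)) m) (admissible-diagonal n) ⟩
  coeff (BellTerm n y (n ∷ []) +P 0P) m               ≡⟨ cong (λ f → coeff f m) (++-identityʳ (BellTerm n y (n ∷ []))) ⟩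
  coeff (BellTerm n y (n ∷ [])) m                     ≡⟨ coeff-BellTerm n y (n ∷ []) m denom-diagonal ⟩
  coeff ((y 1 ^P n) *P 1P) m                          ≡⟨ cong (λ f → coeff f m) (*P-identityʳ (y 1 ^P n)) ⟩
  coeff (y 1 ^P n) m                                  ∎
  where
  denom-diagonal : denom 1 (n ∷ []) ≡ n !
  denom-diagonal = trans (ℕP.*-identityʳ (n ! ℕ.* 1 ℕ.^ n))
                         (trans (cong (n ! ℕ.*_) (ℕP.^-zeroˡ n)) (ℕP.*-identityʳ (n !)))

module _ {y : ℕ → Poly} (no-const : ∀ t → constTerm (y t) ≡ + 0) where

  constTerm-Bell : ∀ N k → 1 ≤ k → constTerm (Bell N k y) ≡ + 0
  constTerm-Bell N k k≥1 = coeff-Bell-zero N k y []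
    (λ {js} (_ , s) → constTerm-monoB no-const 1 js (subst (1 ≤_) (sym s) k≥1))

  linCoeff-Bell : ∀ i N k → 2 ≤ k → linCoeff i (Bell N k y) ≡ + 0
  linCoeff-Bell i N k k≥2 = coeff-Bell-zero N k y (i ∷ [])
    (λ {js} (_ , s) → linCoeff-monoB no-const i 1 js (subst (2 ≤_) (sym s) k≥2))

-- The sequence ψ

range-lower : ∀ a b → All (a ≤_) (range a b)
range-lower a b = AllP.map⁺ (AllP.applyUpTo⁺₂ id (suc b ∸ a) (ℕP.m≤m+n a))

σ⋆Arg : ℕ → Poly
σ⋆Arg i = scale (- (+ ((i ∸ 1) !))) (x i)

orderAtMost-σ⋆Arg : ∀ t → OrderAtMost t (σ⋆Arg t)
orderAtMost-σ⋆Arg t = ℕP.≤-reflexive (ℕP.+-identityʳ t) ∷ []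

constTerm-σ⋆Arg : ∀ t → constTerm (σ⋆Arg t) ≡ + 0
constTerm-σ⋆Arg t = trans (coeff-scale (- (+ ((t ∸ 1) !))) (x t) []) (ℤP.*-zeroʳ (- (+ ((t ∸ 1) !))))

orderAtMost-σ⋆ : ∀ N → OrderAtMost N (σ⋆ N)
orderAtMost-σ⋆ N = orderAtMost-scale ((- + 1) ^ N)
  (orderAtMost-ΣP (AllP.map⁺ (All.universal (orderAtMost-Bell orderAtMost-σ⋆Arg N) (range 1 N))))

constTerm-σ⋆ : ∀ N → constTerm (σ⋆ N) ≡ + 0
constTerm-σ⋆ N = begin
  constTerm (σ⋆ N)                             ≡⟨ coeff-scale ((- + 1) ^ N) (BellTotal N σ⋆Arg) [] ⟩
  (- + 1) ^ N * constTerm (BellTotal N σ⋆Arg)  ≡⟨ cong ((- + 1) ^ N *_) (coeff-ΣP-zero (AllP.map⁺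
                                                    (All.map (λ {k} → constTerm-Bell constTerm-σ⋆Arg N k) (range-lower 1 N)))) ⟩
  (- + 1) ^ N * + 0                            ≡⟨ ℤP.*-zeroʳ ((- + 1) ^ N) ⟩
  + 0                                          ∎

linCoeff-σ⋆ : ∀ i M → linCoeff i (σ⋆ (suc M)) ≡ (- + 1) ^ suc M * linCoeff i (σ⋆Arg (suc M))
linCoeff-σ⋆ i M = begin
  linCoeff i (σ⋆ (suc M))                                ≡⟨ coeff-scale sign (B₁ +P higher) (i ∷ []) ⟩
  sign * linCoeff i (B₁ +P higher)                       ≡⟨ cong (sign *_) (coeff-+P B₁ higher (i ∷ [])) ⟩
  sign * (linCoeff i B₁ + linCoeff i higher)             ≡⟨ cong₂ (λ u v → sign * (u + v))
                                                              (coeff-Bell-unit (suc M) σ⋆Arg (i ∷ []) (s≤s z≤n)) higher-vanishes ⟩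
  sign * (linCoeff i (σ⋆Arg (suc M)) + + 0)              ≡⟨ cong (sign *_) (ℤP.+-identityʳ (linCoeff i (σ⋆Arg (suc M)))) ⟩
  sign * linCoeff i (σ⋆Arg (suc M))                      ∎
  where
  sign : ℤ
  sign = (- + 1) ^ suc M
  B₁ higher : Poly
  B₁ = Bell (suc M) 1 σ⋆Arg
  higher = ΣP (map (λ k → Bell (suc M) k σ⋆Arg) (map (1 ℕ.+_) (applyUpTo suc M)))
  higher-vanishes : linCoeff i higher ≡ + 0
  higher-vanishes = coeff-ΣP-zero (AllP.map⁺ (AllP.map⁺ (AllP.applyUpTo⁺₂ suc M
    (λ j → linCoeff-Bell constTerm-σ⋆Arg i (suc M) (suc (suc j)) (s≤s (s≤s z≤n))))))

module _ {φ : ℕ → Poly} where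

  orderAtMost-ΨWith : (∀ t → OrderAtMost t (φ t)) → ∀ n → OrderAtMost n (ΨWith φ n)
  orderAtMost-ΨWith hφ n = orderAtMost-ΣP (AllP.map⁺ (All.universal (λ ν → orderAtMost-ΣP (AllP.map⁺ (All.universal (λ k →
    orderAtMost-scale ((- + 1) ^ (ν ℕ.+ 1) * S₁ (ν ℕ.+ 1) (k ℕ.+ 1) * + (n P k))
      (orderAtMost-mono (ℕP.m∸n≤m n k) (orderAtMost-Bell hφ (n ∸ k) ν))) (range 0 (ν ℕ.⊓ (n ∸ ν)))))) (range 2 n)))

  coeff-ΨWith-zero : ∀ n m → (∀ N ν → 2 ≤ ν → coeff (Bell N ν φ) m ≡ + 0) → coeff (ΨWith φ n) m ≡ + 0
  coeff-ΨWith-zero n m h = coeff-ΣP-zero (AllP.map⁺ (All.map (λ {ν} → inner ν) (range-lower 2 n)))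
    where
    c : ℕ → ℕ → ℤ
    c ν k = (- + 1) ^ (ν ℕ.+ 1) * S₁ (ν ℕ.+ 1) (k ℕ.+ 1) * + (n P k)
    inner : ∀ ν → 2 ≤ ν →
            coeff (ΣP (map (λ k → scale (c ν k) (Bell (n ∸ k) ν φ)) (range 0 (ν ℕ.⊓ (n ∸ ν))))) m ≡ + 0
    inner ν ν≥2 = coeff-ΣP-zero (AllP.map⁺ {f = λ k → scale (c ν k) (Bell (n ∸ k) ν φ)} (All.universal (λ k →
      trans (coeff-scale (c ν k) (Bell (n ∸ k) ν φ) m) (trans (cong (c ν k *_) (h (n ∸ k) ν ν≥2)) (ℤP.*-zeroʳ (c ν k))))
      (range 0 (ν ℕ.⊓ (n ∸ ν)))))

ψStep : (ℕ → Poly) → ℕ → Poly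
ψStep φ n = scale (+ suc n) (φ n) +P (σ⋆ (suc n) +P ΨWith φ (suc n))

ψ-suc : ∀ n → ψ (suc n) ≡ ψStep (ψtab n) n
ψ-suc n with n ℕ.<ᵇ n in eq
... | false = refl
... | true = contradiction (ℕP.<ᵇ⇒< n n (subst T (sym eq) _)) (ℕP.<-irrefl refl)

-- Row n of ψtab holds ψ₀, …, ψₙ and repeats ψₙ beyond n; every new entry is a ψStep of the previous row.
ψtab-ind : (Q : ℕ → Poly → Set) → (∀ i → Q i 0P) →
           (∀ n i → n < i → (∀ j → Q j (ψtab n j)) → Q i (ψStep (ψtab n) n)) →
           ∀ n i → Q i (ψtab n i)
ψtab-ind Q base step zero i = base i
ψtab-ind Q base step (suc n) i with i ℕ.≤ᵇ n in eq
... | true = ψtab-ind Q base step n i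
... | false = step n i (ℕP.≰⇒> (λ i≤n → subst T eq (ℕP.≤⇒≤ᵇ i≤n))) (ψtab-ind Q base step n)

orderAtMost-ψStep : ∀ {φ} → (∀ t → OrderAtMost t (φ t)) → ∀ n → OrderAtMost (suc n) (ψStep φ n)
orderAtMost-ψStep hφ n = AllP.++⁺ (orderAtMost-scale (+ suc n) (orderAtMost-mono (ℕP.n≤1+n n) (hφ n)))
                                  (AllP.++⁺ (orderAtMost-σ⋆ (suc n)) (orderAtMost-ΨWith hφ (suc n)))

coeff-ψStep : ∀ φ n m → coeff (ΨWith φ (suc n)) m ≡ + 0 →
              coeff (ψStep φ n) m ≡ + suc n * coeff (φ n) m + coeff (σ⋆ (suc n)) m
coeff-ψStep φ n m Ψ₀ = begin
  coeff (scale (+ suc n) (φ n) +P (σ⋆ (suc n) +P ΨWith φ (suc n))) m     ≡⟨ coeff-+P (scale (+ suc n) (φ n)) _ m ⟩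
  coeff (scale (+ suc n) (φ n)) m + coeff (σ⋆ (suc n) +P ΨWith φ (suc n)) m
                                                                       ≡⟨ cong₂ _+_ (coeff-scale (+ suc n) (φ n) m)
                                                                            (coeff-+P (σ⋆ (suc n)) (ΨWith φ (suc n)) m) ⟩
  + suc n * coeff (φ n) m + (coeff (σ⋆ (suc n)) m + coeff (ΨWith φ (suc n)) m)
                                                                       ≡⟨ cong (λ z → + suc n * coeff (φ n) m + (coeff (σ⋆ (suc n)) m + z)) Ψ₀ ⟩
  + suc n * coeff (φ n) m + (coeff (σ⋆ (suc n)) m + + 0)               ≡⟨ cong (λ z → + suc n * coeff (φ n) m + z)
                                                                            (ℤP.+-identityʳ (coeff (σ⋆ (suc n)) m)) ⟩
  + suc n * coeff (φ n) m + coeff (σ⋆ (suc n)) m                       ∎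

module _ {φ : ℕ → Poly} (no-const : ∀ t → constTerm (φ t) ≡ + 0) where

  constTerm-ψStep : ∀ n → constTerm (ψStep φ n) ≡ + 0
  constTerm-ψStep n = begin
    constTerm (ψStep φ n)                               ≡⟨ coeff-ψStep φ n [] Ψ₀ ⟩
    + suc n * constTerm (φ n) + constTerm (σ⋆ (suc n))  ≡⟨ cong₂ (λ u v → + suc n * u + v) (no-const n) (constTerm-σ⋆ (suc n)) ⟩
    + suc n * + 0 + + 0                                 ≡⟨ cong (_+ + 0) (ℤP.*-zeroʳ (+ suc n)) ⟩
    + 0                                                 ∎
    where
    Ψ₀ : constTerm (ΨWith φ (suc n)) ≡ + 0
    Ψ₀ = coeff-ΨWith-zero (suc n) [] (λ N ν ν≥2 → constTerm-Bell no-const N ν (ℕP.≤-trans (s≤s z≤n) ν≥2))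

  linCoeff-ψStep : ∀ i n → linCoeff i (ψStep φ n) ≡ + suc n * linCoeff i (φ n) + linCoeff i (σ⋆ (suc n))
  linCoeff-ψStep i n = coeff-ψStep φ n (i ∷ [])
    (coeff-ΨWith-zero (suc n) (i ∷ []) (λ N ν ν≥2 → linCoeff-Bell no-const i N ν ν≥2))

ψtab-orderAtMost : ∀ n i → OrderAtMost i (ψtab n i)
ψtab-orderAtMost = ψtab-ind OrderAtMost (λ _ → [])
  (λ n _ n<i ih → orderAtMost-mono n<i (orderAtMost-ψStep {ψtab n} ih n))

ψtab-constTerm : ∀ n i → constTerm (ψtab n i) ≡ + 0
ψtab-constTerm = ψtab-ind (λ _ f → constTerm f ≡ + 0) (λ _ → refl) (λ n _ _ ih → constTerm-ψStep {ψtab n} ih n)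

ψ-orderAtMost : ∀ n → OrderAtMost n (ψ n)
ψ-orderAtMost n = ψtab-orderAtMost n n

linCoeff-ψ-suc : ∀ i n → linCoeff i (ψ (suc n)) ≡ + suc n * linCoeff i (ψ n) + linCoeff i (σ⋆ (suc n))
linCoeff-ψ-suc i n = trans (cong (linCoeff i) (ψ-suc n)) (linCoeff-ψStep {ψtab n} (ψtab-constTerm n) i n)

linCoeff-x-self : ∀ i → linCoeff i (x i) ≡ + 1
linCoeff-x-self i = coeff-∷-≡ (i ∷ []) (+ 1) [] (i ∷ []) refl

linCoeff-ψ-1 : ∀ M → linCoeff 1 (ψ (suc M)) ≡ + (suc M !)
linCoeff-ψ-1 zero = refl
linCoeff-ψ-1 (suc M) = begin
  linCoeff 1 (ψ (suc (suc M)))                                            ≡⟨ linCoeff-ψ-suc 1 (suc M) ⟩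
  + suc (suc M) * linCoeff 1 (ψ (suc M)) + linCoeff 1 (σ⋆ (suc (suc M)))  ≡⟨ cong₂ _+_ (cong (+ suc (suc M) *_) (linCoeff-ψ-1 M))
                                                                                        σ⋆-part ⟩
  + suc (suc M) * + (suc M !) + + 0                                       ≡⟨ ℤP.+-identityʳ (+ suc (suc M) * + (suc M !)) ⟩
  + suc (suc M) * + (suc M !)                                             ≡⟨ sym (ℤP.pos-* (suc (suc M)) (suc M !)) ⟩
  + (suc (suc M) !)                                                       ∎
  where
  σ⋆-part : linCoeff 1 (σ⋆ (suc (suc M))) ≡ + 0
  σ⋆-part = begin
    linCoeff 1 (σ⋆ (suc (suc M)))                              ≡⟨ linCoeff-σ⋆ 1 (suc M) ⟩
    (- + 1) ^ suc (suc M) * linCoeff 1 (σ⋆Arg (suc (suc M)))   ≡⟨ cong ((- + 1) ^ suc (suc M) *_)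
                                                                    (coeff-scale (- + (suc M !)) (x (suc (suc M))) (1 ∷ [])) ⟩
    (- + 1) ^ suc (suc M) * (- + (suc M !) * + 0)              ≡⟨ cong ((- + 1) ^ suc (suc M) *_) (ℤP.*-zeroʳ (- + (suc M !))) ⟩
    (- + 1) ^ suc (suc M) * + 0                                ≡⟨ ℤP.*-zeroʳ ((- + 1) ^ suc (suc M)) ⟩
    + 0                                                        ∎

linCoeff-ψ-top : ∀ M → linCoeff (suc (suc M)) (ψ (suc (suc M))) ≡ (- + 1) ^ suc M * + (suc M !)
linCoeff-ψ-top M = begin
  linCoeff t (ψ t)                                               ≡⟨ linCoeff-ψ-suc t (suc M) ⟩
  + t * linCoeff t (ψ (suc M)) + linCoeff t (σ⋆ t)               ≡⟨ cong₂ (λ u v → + t * u + v) beyond (linCoeff-σ⋆ t (suc M)) ⟩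
  + t * + 0 + (- + 1) ^ t * linCoeff t (σ⋆Arg t)                 ≡⟨ cong (λ z → + t * + 0 + (- + 1) ^ t * z)
                                                                      (trans (coeff-scale (- + (suc M !)) (x t) (t ∷ []))
                                                                             (cong (- + (suc M !) *_) (linCoeff-x-self t))) ⟩
  + t * + 0 + (- + 1) * (- + 1) ^ suc M * (- + (suc M !) * + 1)  ≡⟨ rearrange (+ t) ((- + 1) ^ suc M) (+ (suc M !)) ⟩
  (- + 1) ^ suc M * + (suc M !)                                  ∎
  where
  t : ℕ
  t = suc (suc M)
  beyond : linCoeff t (ψ (suc M)) ≡ + 0
  beyond = coeff-beyond-order (ψ (suc M)) (t ∷ []) (ψ-orderAtMost (suc M)) (ℕP.m≤m+n t 0)
  rearrange : ∀ a s f → a * + 0 + (- + 1) * s * (- f * + 1) ≡ s * f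
  rearrange = solve-∀

sign-factorial≢0 : ∀ m → (- + 1) ^ m * + (m !) ≢ + 0
sign-factorial≢0 m e = [ (λ ()) ∘ ℤP.i^n≡0⇒i≡0 (- + 1) m , ℕP.<⇒≢ (ℕP.1≤n! m) ∘ sym ∘ ℤP.+-injective ]′
  (ℤP.i*j≡0⇒i≡0∨j≡0 ((- + 1) ^ m) e)

norm-ψ : ∀ n → 1 ≤ n → norm (ψ n) ≡ n
norm-ψ (suc M) _ = ℕP.≤-antisym (norm-≤ (ψ (suc M)) (ψ-orderAtMost (suc M)))
  (subst (_≤ norm (ψ (suc M))) (ℕP.+-identityʳ (suc M)) (order≤norm (ψ (suc M)) (suc M ∷ []) (top≢0 M)))
  where
  top≢0 : ∀ M → linCoeff (suc M) (ψ (suc M)) ≢ + 0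
  top≢0 zero = λ ()
  top≢0 (suc M) = sign-factorial≢0 (suc M) ∘ trans (sym (linCoeff-ψ-top M))

x-^P : ∀ i n → x i ^P n ≡ (replicate n i , + 1) ∷ []
x-^P i zero = refl
x-^P i (suc n) rewrite x-^P i n = refl

order-replicate : ∀ n i → order (replicate n i) ≡ n ℕ.* i
order-replicate zero i = refl
order-replicate (suc n) i = cong (i ℕ.+_) (order-replicate n i)

norm-Bell-diagonal : ∀ n → norm (Bell n n ψ) ≡ n
norm-Bell-diagonal n = ℕP.≤-antisym (norm-≤ (Bell n n ψ) (orderAtMost-Bell ψ-orderAtMost n n))
  (subst (_≤ norm (Bell n n ψ)) (trans (order-replicate n 1) (ℕP.*-identityʳ n))
         (order≤norm (Bell n n ψ) ones ones≢0))
  where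
  ones : Monomial
  ones = replicate n 1
  ones≢0 : coeff (Bell n n ψ) ones ≢ + 0
  ones≢0 e with () ← begin
    + 1 + + 0                      ≡⟨ sym (coeff-∷-≡ ones (+ 1) [] ones refl) ⟩
    coeff ((ones , + 1) ∷ []) ones  ≡⟨ cong (λ f → coeff f ones) (sym (x-^P 1 n)) ⟩
    coeff (x 1 ^P n) ones          ≡⟨ sym (coeff-Bell-diagonal n ψ ones) ⟩
    coeff (Bell n n ψ) ones        ≡⟨ e ⟩
    + 0                            ∎

linCoeffs-ψ : ∀ n → 2 ≤ n →
  coeff (ψ n) (1 ∷ []) ≡ + (n !) × coeff (ψ n) (n ∷ []) ≡ (- + 1) ^ (n ∸ 1) * + ((n ∸ 1) !)
linCoeffs-ψ (suc zero) (s≤s ())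
linCoeffs-ψ (suc (suc M)) _ = linCoeff-ψ-1 (suc M) , linCoeff-ψ-top M

theorem4p3 :
    ((n : ℕ) → 1 ≤ n →
        (norm (ψ n) ≡ n)
      × (norm (Ψ n) ≤ n)
      × ((k : ℕ) → 1 ≤ k → k ≤ n → norm (Bell n k ψ) ≤ n)
      × ((m : Monomial) → coeff (Bell n n ψ) m ≡ coeff (x 1 ^P n) m)
      × (norm (Bell n n ψ) ≡ n))
    × ((n : ℕ) → 2 ≤ n →
        (coeff (ψ n) (1 ∷ []) ≡ + (n !))
      × (coeff (ψ n) (n ∷ []) ≡ ((- + 1) ^ (n ∸ 1)) * + ((n ∸ 1) !)))
theorem4p3 =
  (λ n n≥1 → norm-ψ n n≥1
           , norm-≤ (Ψ n) (orderAtMost-ΨWith ψ-orderAtMost n)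
           , (λ k _ _ → norm-≤ (Bell n k ψ) (orderAtMost-Bell ψ-orderAtMost n k))
           , coeff-Bell-diagonal n ψ
           , norm-Bell-diagonal n)
  , linCoeffs-ψ
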